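{- For all integers $m>n\ge0$, $$\sum_{k=0}^{n}(-1)^k\frac{(m-n)(k+1)(k+2)(2k+3)}{(n+1)(2n+3)(m+1)(2m+3)}\binom{2n+3}{n-k}\binom{2m+3}{m-k}=\sum_{j=0}^{\lfloor\frac{m-n-1}{2}\rfloor}(-1)^j\binom{m-n-1-j}{j}C_{n+j+1}\,4^{m-n-1-2j},$$ where $C_j=\frac{1}{j+1}\binom{2j}{j}$ is the $j$-th Catalan number. -}

module Defs where

open import Data.Nat as ℕ using (ℕ; zero; suc; _∸_; _^_)
open import Data.Nat.Combinatorics using (_C_)
open import Data.Integer as ℤ using (ℤ; +_)
open import Data.Rational as ℚ using (ℚ; _/_; _+_; _*_; -_)

sumTo : ℕ → (ℕ → ℚ) → ℚ
sumTo zero    f = f 0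
sumTo (suc n) f = sumTo n f + f (suc n)

sign : ℕ → ℚ
sign zero    = ℚ.1ℚ
sign (suc k) = - sign k

ℕ→ℚ : ℕ → ℚ
ℕ→ℚ n = (+ n) / 1

catalan : ℕ → ℚ
catalan j = (+ ((2 ℕ.* j) C j)) / suc j

lhsTerm : ℕ → ℕ → ℕ → ℚ
lhsTerm m n k =
  sign k *
  ((+ ((m ∸ n) ℕ.* (k ℕ.+ 1) ℕ.* (k ℕ.+ 2) ℕ.* (2 ℕ.* k ℕ.+ 3)))
     / (suc n ℕ.* (3 ℕ.+ 2 ℕ.* n) ℕ.* suc m ℕ.* (3 ℕ.+ 2 ℕ.* m)))
  * ℕ→ℚ ((2 ℕ.* n ℕ.+ 3) C (n ∸ k))
  * ℕ→ℚ ((2 ℕ.* m ℕ.+ 3) C (m ∸ k))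

rhsTerm : ℕ → ℕ → ℕ → ℚ
rhsTerm m n j =
  sign j * ℕ→ℚ ((m ∸ n ∸ 1 ∸ j) C j) * catalan (n ℕ.+ j ℕ.+ 1)
  * ℕ→ℚ (4 ^ (m ∸ n ∸ 1 ∸ 2 ℕ.* j))

-- Put P(x) = (x+1)(2x+3), w(k) = (k+1)(k+2)(2k+3) and
--   σ(n,m) = Σₖ (-1)ᵏ w(k) C(2n+3, n+k+3) C(2m+3, m+k+3),
-- so that the left-hand side is (m-n) σ(n,m) / (P(n) P(m)).  Creative telescoping
-- (Zeilberger) yields two recurrences for σ, each certified by an explicit
-- antidifference: (n+1) σ(n+1,n+2) = 2(2n+7) σ(n,n+1), whence σ(n,n+1) = P(n) P(n+1) C_{n+1},
-- and a three-term recurrence which says exactly that F(n,d) = d σ(n,n+d) / (P(n) P(n+d))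
-- satisfies F(n,d+2) = 4 F(n,d+1) - F(n+1,d).  Pascal's rule for C(e-j, j) shows that the
-- right-hand side obeys the same recurrence with the same initial values.
-- Divided by a suitable product of two binomials, each telescoping identity becomes a
-- polynomial identity.
module Submission where

open import Defs
open import Level using (0ℓ)
open import Function using (_∘_)
open import Data.Nat as ℕ using (ℕ; zero; suc; _∸_; _^_; _<_; _≤_; _/_; z≤n; s≤s)
import Data.Nat.Properties as ℕP
open import Data.Nat.DivMod using (m≡m%n+[m/n]*n; m%n<n; m/n≤m)
open import Data.Nat.Combinatorics using (_C_; nCk+nC[k+1]≡[n+1]C[k+1]; k>n⇒nCk≡0; nC1≡n; nCk≡nC[n∸k])
open import Data.Integer as ℤ using (ℤ; +_; 0ℤ; 1ℤ)
import Data.Integer.Properties as ℤP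
open import Data.Rational as ℚ using (ℚ)
import Data.Rational.Properties as ℚP
open import Data.Rational.Unnormalised as ℚᵘ using (mkℚᵘ; _≃_; *≡*)
import Data.Rational.Unnormalised.Properties as ℚᵘP
open import Data.Rational.Solver using (module +-*-Solver)
open import Data.Product using (_×_; _,_; proj₁; proj₂)
open import Data.List using (List; []; _∷_; map)
open import Data.Unit using (tt)
open import Data.Vec.N-ary using (N-ary; Eq; curryⁿ; curryⁿ-cong)
open import Algebra.Bundles.Raw using (RawRing)
open import Relation.Nullary using (yes; no)
open import Relation.Binary.PropositionalEquality
open import Data.Integer.Tactic.RingSolver using (ring; solve-∀)
import Data.Nat.Tactic.RingSolver as ℕ-Solver
open import Tactic.RingSolver.Core.Expression using (Expr; Κ; ⊝_) renaming (_⊕_ to _⊕ₑ_; _⊗_ to _⊗ₑ_)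
open import Tactic.RingSolver.Core.Polynomial.Parameters using (module Homomorphism)
open import Tactic.RingSolver.NonReflective ring using (module Ops)
open Ops using (norm; correct; homo; ⟦_⟧; close)
open import Tactic.RingSolver.Core.Polynomial.Base (Homomorphism.from homo) using (Zero)
open import Tactic.RingSolver.Core.Polynomial.Homomorphism.Lemmas homo using (zero-hom)

-- For a true identity `Zero (norm …)` evaluates to ⊤, so no symbolic evaluation is needed;
-- this is what makes the large certificate identities feasible, where `solve-∀` is not.
polynomial-identity : ∀ n (f : N-ary n (Expr ℤ n) (Expr ℤ n × Expr ℤ n)) →
  Zero (norm (proj₁ (close n f) ⊕ₑ ⊝ proj₂ (close n f))) →
  Eq n _≡_ (curryⁿ ⟦ proj₁ (close n f) ⟧) (curryⁿ ⟦ proj₂ (close n f) ⟧)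
polynomial-identity n f zero-normal-form = curryⁿ-cong _≡_ _ _ λ ρ →
  ℤP.i-j≡0⇒i≡j _ _ (trans (sym (correct (e₁ ⊕ₑ ⊝ e₂) ρ))
                          (sym (zero-hom (norm (e₁ ⊕ₑ ⊝ e₂)) zero-normal-form ρ)))
  where
  e₁ = proj₁ (close n f)
  e₂ = proj₂ (close n f)

expressionRawRing : ℕ → RawRing 0ℓ 0ℓ
expressionRawRing m = record
  { Carrier = Expr ℤ m ; _≈_ = _≡_ ; _+_ = _⊕ₑ_ ; _*_ = _⊗ₑ_ ; -_ = ⊝_ ; 0# = Κ 0ℤ ; 1# = Κ 1ℤ }

-- The polynomials of the proof, over an arbitrary raw ring: instantiated at ℤ they are the
-- coefficients, instantiated at `expressionRawRing` they are syntax for the normaliser.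
-- Positive factors are written constant first (`3 + (x + x)`), so that at ℤ their
-- non-vanishing is evident by computation.  `den ν` and `r_ab ν κ` describe the binomial
-- C(2ν+a, ν+κ+b) as the multiple r_ab/den of C(2ν+5, ν+κ+4), and each triple (a , r , r′)
-- in `base-ratios` and `recurrence-ratios` is a term a·x·y of a telescoping identity, with
-- x and y replaced by their ratios r and r′.
module Polynomials (R : RawRing 0ℓ 0ℓ) (constant : ℕ → RawRing.Carrier R) where
  open RawRing R
  open import Agda.Builtin.FromNat using (Number; fromNat)
  open import Data.Unit using (⊤)

  instance
    number : Number Carrier
    number = record { Constraint = λ _ → ⊤ ; fromNat = λ n → constant n }

  infixl 6 _-_
  _-_ : Carrier → Carrier → Carrier
  x - y = x + - y

  P w : Carrier → Carrier
  P x = (1 + x) * (3 + (x + x))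
  w k = (1 + k) * (2 + k) * (3 + (k + k))

  c₀ : Carrier → Carrier
  c₀ n = 2 * (2 + n) * (3 + n)

  c₁ c₂ c₃ : Carrier → Carrier → Carrier
  c₁ n d = (2 + d) * P (1 + n) * P (1 + (n + d))
  c₂ n d = - (4 * (1 + d) * P (1 + n) * P (2 + (n + d)))
  c₃ n d = d * P n * P (2 + (n + d))

  H : Carrier → Carrier → Carrier
  H n k = k * (1 + k) * (2 + k) * (7 + (n + n)) * ((1 + k) * (1 + k) - (2 + n) * (7 + 3 * n))

  G : Carrier → Carrier → Carrier → Carrier
  G n d k = k * (1 + k) * (2 + k) * (1 + d) * (5 + (n + n)) * (5 + (k + (n + d)))
            * (2 * k * k + 4 * k - 2 * n * n - 2 * n * d - 8 * n - 3 * d - 6)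

  den : Carrier → Carrier
  den ν = (5 + (ν + ν)) * (4 + (ν + ν))

  r₃₃ r₄₃ r₄₄ : Carrier → Carrier → Carrier
  r₃₃ ν κ = ((4 + (ν + ν)) - (3 + (κ + ν))) * (4 + (κ + ν))
  r₄₃ ν κ = (4 + (κ + ν)) * (4 + (ν + ν))
  r₄₄ ν κ = ((5 + (ν + ν)) - (4 + (κ + ν))) * (4 + (ν + ν))

  Σ-triples : List (Carrier × Carrier × Carrier) → Carrier
  Σ-triples []                 = 0#
  Σ-triples ((a , x , y) ∷ ts) = a * x * y + Σ-triples ts

  base-ratios : Carrier → Carrier → List (Carrier × Carrier × Carrier)
  base-ratios n k =
    (c₀ n * (1 + n) * w k , den n , den (1 + n)) ∷
    (- (c₀ n * (2 * (7 + (n + n))) * w k) , r₃₃ n k , r₃₃ (1 + n) k) ∷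
    (H n (1 + k) , r₄₄ n k , r₄₄ (1 + n) k) ∷
    (H n k , r₄₃ n k , r₄₃ (1 + n) k) ∷ []

  recurrence-ratios : Carrier → Carrier → Carrier → List (Carrier × Carrier × Carrier)
  recurrence-ratios n d k =
    (2 * c₁ n d * w k , r₃₃ n k , den′) ∷
    (2 * c₂ n d * w k , r₃₃ n k , r₃₃ M k * (5 + (k + M))) ∷
    (2 * c₃ n d * w k , den n , r₃₃ M k * (5 + (k + M))) ∷
    (G n d (1 + k) , r₄₄ n k , den M * ((5 + (M + M)) - (4 + (k + M)))) ∷
    (G n d k , r₄₃ n k , den′) ∷ []
    where
    M = 1 + (n + d)
    den′ = den M * (5 + (k + M))

open Polynomials ℤ.+-*-rawRing +_ hiding (_-_)

module Syntactic {m} = Polynomials (expressionRawRing m) (λ n → Κ (+ n))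

Σ-base-ratios≡0 : ∀ n k → Σ-triples (base-ratios n k) ≡ 0ℤ
Σ-base-ratios≡0 = polynomial-identity 2 (λ n k → Syntactic.Σ-triples (Syntactic.base-ratios n k) , Κ 0ℤ) tt

Σ-recurrence-ratios≡0 : ∀ n d k → Σ-triples (recurrence-ratios n d k) ≡ 0ℤ
Σ-recurrence-ratios≡0 =
  polynomial-identity 3 (λ n d k → Syntactic.Σ-triples (Syntactic.recurrence-ratios n d k) , Κ 0ℤ) tt

open import Data.Integer.Base using (_+_; _*_; _-_; -_)

toℚ : ℤ → ℚ
toℚ i = i ℚ./ 1

private
  toℚᵘ-toℚ : ∀ i → ℚ.toℚᵘ (toℚ i) ≃ mkℚᵘ i 0
  toℚᵘ-toℚ i = ℚP.toℚᵘ-fromℚᵘ (mkℚᵘ i 0)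

  toℚᵘ-/ : ∀ i d → ℚ.toℚᵘ (i ℚ./ suc d) ≃ mkℚᵘ i d
  toℚᵘ-/ i d = ℚP.toℚᵘ-fromℚᵘ (mkℚᵘ i d)

toℚ-+ : ∀ i j → toℚ (i + j) ≡ toℚ i ℚ.+ toℚ j
toℚ-+ i j = ℚP.toℚᵘ-injective (begin
  ℚ.toℚᵘ (toℚ (i + j))                      ≈⟨ toℚᵘ-toℚ (i + j) ⟩
  mkℚᵘ (i + j) 0                            ≈⟨ *≡* (unit i j) ⟩
  mkℚᵘ i 0 ℚᵘ.+ mkℚᵘ j 0                    ≈⟨ ℚᵘP.+-cong (toℚᵘ-toℚ i) (toℚᵘ-toℚ j) ⟨
  ℚ.toℚᵘ (toℚ i) ℚᵘ.+ ℚ.toℚᵘ (toℚ j)        ≈⟨ ℚP.toℚᵘ-homo-+ (toℚ i) (toℚ j) ⟨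
  ℚ.toℚᵘ (toℚ i ℚ.+ toℚ j)                  ∎)
  where
  open ℚᵘP.≃-Reasoning
  unit : ∀ i j → (i + j) * 1ℤ ≡ (i * 1ℤ + j * 1ℤ) * 1ℤ
  unit = solve-∀

toℚ-* : ∀ i j → toℚ (i * j) ≡ toℚ i ℚ.* toℚ j
toℚ-* i j = ℚP.toℚᵘ-injective (begin
  ℚ.toℚᵘ (toℚ (i * j))                      ≈⟨ toℚᵘ-toℚ (i * j) ⟩
  mkℚᵘ (i * j) 0                            ≈⟨ *≡* refl ⟩
  mkℚᵘ i 0 ℚᵘ.* mkℚᵘ j 0                    ≈⟨ ℚᵘP.*-cong (toℚᵘ-toℚ i) (toℚᵘ-toℚ j) ⟨
  ℚ.toℚᵘ (toℚ i) ℚᵘ.* ℚ.toℚᵘ (toℚ j)        ≈⟨ ℚP.toℚᵘ-homo-* (toℚ i) (toℚ j) ⟨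
  ℚ.toℚᵘ (toℚ i ℚ.* toℚ j)                  ∎)
  where open ℚᵘP.≃-Reasoning

toℚ-neg : ∀ i → toℚ (- i) ≡ ℚ.- toℚ i
toℚ-neg i = ℚP.toℚᵘ-injective (begin
  ℚ.toℚᵘ (toℚ (- i))        ≈⟨ toℚᵘ-toℚ (- i) ⟩
  mkℚᵘ (- i) 0              ≈⟨ ℚᵘP.-‿cong (toℚᵘ-toℚ i) ⟨
  ℚᵘ.- ℚ.toℚᵘ (toℚ i)       ≈⟨ ℚP.toℚᵘ-homo‿- (toℚ i) ⟨
  ℚ.toℚᵘ (ℚ.- toℚ i)        ∎)
  where open ℚᵘP.≃-Reasoning

/-exact : ∀ i c d → i ≡ + suc d * c → i ℚ./ suc d ≡ toℚ c
/-exact i c d i≡dc = ℚP.toℚᵘ-injective (begin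
  ℚ.toℚᵘ (i ℚ./ suc d)    ≈⟨ toℚᵘ-/ i d ⟩
  mkℚᵘ i d                ≈⟨ *≡* (trans (cong (_* 1ℤ) i≡dc) (swap (+ suc d) c)) ⟩
  mkℚᵘ c 0                ≈⟨ toℚᵘ-toℚ c ⟨
  ℚ.toℚᵘ (toℚ c)          ∎)
  where
  open ℚᵘP.≃-Reasoning
  swap : ∀ d c → d * c * 1ℤ ≡ c * d
  swap = solve-∀

/-split : ∀ i d → i ℚ./ suc d ≡ toℚ i ℚ.* (+ 1 ℚ./ suc d)
/-split i d = ℚP.toℚᵘ-injective (begin
  ℚ.toℚᵘ (i ℚ./ suc d)                          ≈⟨ toℚᵘ-/ i d ⟩
  mkℚᵘ i d                                      ≈⟨ *≡* (trans (cong (λ x → i * + suc x) (ℕP.+-identityʳ d))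
                                                                 (unit i (+ suc d))) ⟩
  mkℚᵘ i 0 ℚᵘ.* mkℚᵘ (+ 1) d                    ≈⟨ ℚᵘP.*-cong (toℚᵘ-toℚ i) (toℚᵘ-/ (+ 1) d) ⟨
  ℚ.toℚᵘ (toℚ i) ℚᵘ.* ℚ.toℚᵘ (+ 1 ℚ./ suc d)    ≈⟨ ℚP.toℚᵘ-homo-* (toℚ i) (+ 1 ℚ./ suc d) ⟨
  ℚ.toℚᵘ (toℚ i ℚ.* (+ 1 ℚ./ suc d))            ∎)
  where
  open ℚᵘP.≃-Reasoning
  unit : ∀ i d → i * d ≡ i * 1ℤ * d
  unit = solve-∀

open ≡-Reasoning

cong₃ : ∀ {A B C D : Set} (f : A → B → C → D) {x x′ y y′ z z′} →
        x ≡ x′ → y ≡ y′ → z ≡ z′ → f x y z ≡ f x′ y′ z′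
cong₃ f refl refl refl = refl

-- Ratios of binomial coefficients

binomial : ℕ → ℕ → ℤ
binomial n k = + (n C k)

-- B ν κ a b = C(2ν + a, ν + κ + b); with the constants in front, raising κ by one is
-- definitionally raising b by one.
B : ℕ → ℕ → ℕ → ℕ → ℤ
B ν κ a b = binomial (a ℕ.+ (ν ℕ.+ ν)) (b ℕ.+ (κ ℕ.+ ν))

binomial-below : ∀ {n k} → n < k → binomial n k ≡ 0ℤ
binomial-below n<k = cong +_ (k>n⇒nCk≡0 n<k)

pascal : ∀ n k → binomial (suc n) (suc k) ≡ binomial n k + binomial n (suc k)
pascal n k = trans (cong +_ (sym (nCk+nC[k+1]≡[n+1]C[k+1] n k))) (ℤP.pos-+ (n C k) (n C suc k))

[1+k]*[1+n]C[1+k]≡[1+n]*nCk : ∀ n k → suc k ℕ.* (suc n C suc k) ≡ suc n ℕ.* (n C k)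
[1+k]*[1+n]C[1+k]≡[1+n]*nCk zero    zero    = refl
[1+k]*[1+n]C[1+k]≡[1+n]*nCk zero    (suc k) = ℕP.*-zeroʳ (suc (suc k))
[1+k]*[1+n]C[1+k]≡[1+n]*nCk (suc n) zero    =
  trans (ℕP.*-identityˡ _) (trans (nC1≡n (suc (suc n))) (sym (ℕP.*-identityʳ _)))
[1+k]*[1+n]C[1+k]≡[1+n]*nCk (suc n) (suc k) = begin
  suc (suc k) ℕ.* (suc (suc n) C suc (suc k))
    ≡⟨ cong (suc (suc k) ℕ.*_) (nCk+nC[k+1]≡[n+1]C[k+1] (suc n) (suc k)) ⟨
  suc (suc k) ℕ.* (a ℕ.+ b)
    ≡⟨ distribute (suc k) a b ⟩
  suc k ℕ.* a ℕ.+ suc (suc k) ℕ.* b ℕ.+ a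
    ≡⟨ cong₂ (λ u v → u ℕ.+ v ℕ.+ a) ([1+k]*[1+n]C[1+k]≡[1+n]*nCk n k) ([1+k]*[1+n]C[1+k]≡[1+n]*nCk n (suc k)) ⟩
  suc n ℕ.* (n C k) ℕ.+ suc n ℕ.* (n C suc k) ℕ.+ a
    ≡⟨ cong (ℕ._+ a) (ℕP.*-distribˡ-+ (suc n) (n C k) (n C suc k)) ⟨
  suc n ℕ.* (n C k ℕ.+ n C suc k) ℕ.+ a
    ≡⟨ cong (λ u → suc n ℕ.* u ℕ.+ a) (nCk+nC[k+1]≡[n+1]C[k+1] n k) ⟩
  suc n ℕ.* a ℕ.+ a
    ≡⟨ ℕP.+-comm (suc n ℕ.* a) a ⟩
  suc (suc n) ℕ.* a ∎
  where
  a = suc n C suc k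
  b = suc n C suc (suc k)
  distribute : ∀ x a b → suc x ℕ.* (a ℕ.+ b) ≡ x ℕ.* a ℕ.+ suc x ℕ.* b ℕ.+ a
  distribute = ℕ-Solver.solve-∀

-- Ratio d x n y says d·x = n·y, i.e. x = (n/d)·y.  It is a record rather than an equation
-- so that unification can read off its four indices.
record Ratio (d x n y : ℤ) : Set where
  constructor ratio
  field
    cross : d * x ≡ n * y

absorption : ∀ n k → Ratio (+ suc n) (binomial n k) (+ suc k) (binomial (suc n) (suc k))
absorption n k = ratio (begin
  + suc n * binomial n k               ≡⟨ ℤP.pos-* (suc n) (n C k) ⟨
  + (suc n ℕ.* (n C k))                ≡⟨ cong +_ ([1+k]*[1+n]C[1+k]≡[1+n]*nCk n k) ⟨
  + (suc k ℕ.* (suc n C suc k))        ≡⟨ ℤP.pos-* (suc k) (suc n C suc k) ⟩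
  + suc k * binomial (suc n) (suc k)   ∎)

upper-step : ∀ n k → Ratio (+ suc n) (binomial n k) (+ suc n - + k) (binomial (suc n) k)
upper-step n zero    = ratio (cong (_* 1ℤ) (sym (ℤP.+-identityʳ (+ suc n))))
upper-step n (suc k) = ratio (sym (begin
  (N - K) * c          ≡⟨ distribute N K c ⟩
  N * c - K * c        ≡⟨ cong₂ (λ u v → N * u - v) (pascal n k) (sym (Ratio.cross (absorption n k))) ⟩
  N * (a + b) - N * a  ≡⟨ cancel N a b ⟩
  N * b                ∎))
  where
  N = + suc n
  K = + suc k
  a = binomial n k
  b = binomial n (suc k)
  c = binomial (suc n) (suc k)
  distribute : ∀ N K c → (N - K) * c ≡ N * c - K * c
  distribute = solve-∀
  cancel : ∀ N a b → N * (a + b) - N * a ≡ N * b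
  cancel = solve-∀

lower-step : ∀ n k → Ratio (+ suc k) (binomial n (suc k)) (+ n - + k) (binomial n k)
lower-step n k = ratio (begin
  K * b              ≡⟨ cong (K *_) (pascal′ {a} {b} (pascal n k)) ⟩
  K * (c - a)        ≡⟨ distribute K c a ⟩
  K * c - K * a      ≡⟨ cong (_- K * a) (Ratio.cross (absorption n k)) ⟨
  N * a - K * a      ≡⟨ collect (+ n) (+ k) a ⟩
  (+ n - + k) * a    ∎)
  where
  N = + suc n
  K = + suc k
  a = binomial n k
  b = binomial n (suc k)
  c = binomial (suc n) (suc k)
  pascal′ : ∀ {a b c} → c ≡ a + b → b ≡ c - a
  pascal′ {a} {b} refl = cancel a b
    where
    cancel : ∀ a b → b ≡ a + b - a
    cancel = solve-∀
  distribute : ∀ K c a → K * (c - a) ≡ K * c - K * a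
  distribute = solve-∀
  collect : ∀ n k a → (1ℤ + n) * a - (1ℤ + k) * a ≡ (n - k) * a
  collect = solve-∀

ratio-≡ : ∀ {d x y} → x ≡ y → Ratio d x d y
ratio-≡ {d} x≡y = ratio (cong (d *_) x≡y)

ratio-trans : ∀ {a b c d x y z} → Ratio a x b y → Ratio c y d z → Ratio (c * a) x (b * d) z
ratio-trans {a} {b} {c} {d} {x} {y} {z} (ratio p) (ratio q) = ratio (begin
  (c * a) * x   ≡⟨ ℤP.*-assoc c a x ⟩
  c * (a * x)   ≡⟨ cong (c *_) p ⟩
  c * (b * y)   ≡⟨ swap c b y ⟩
  b * (c * y)   ≡⟨ cong (b *_) q ⟩
  b * (d * z)   ≡⟨ ℤP.*-assoc b d z ⟨
  (b * d) * z   ∎)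
  where
  swap : ∀ c b y → c * (b * y) ≡ b * (c * y)
  swap = solve-∀

ratio-scaleʳ : ∀ {a b x y} c → Ratio a x b y → Ratio (a * c) x (b * c) y
ratio-scaleʳ {a} {b} {x} {y} c (ratio p) = ratio (begin
  (a * c) * x   ≡⟨ swap a c x ⟩
  (a * x) * c   ≡⟨ cong (_* c) p ⟩
  (b * y) * c   ≡⟨ swap b y c ⟩
  (b * c) * y   ∎)
  where
  swap : ∀ a c x → (a * c) * x ≡ (a * x) * c
  swap = solve-∀

ratio-scaleˡ : ∀ {a b x y} c → Ratio a x b y → Ratio (c * a) x (c * b) y
ratio-scaleˡ {a} {b} {x} {y} c (ratio p) = ratio (begin
  (c * a) * x   ≡⟨ ℤP.*-assoc c a x ⟩
  c * (a * x)   ≡⟨ cong (c *_) p ⟩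
  c * (b * y)   ≡⟨ ℤP.*-assoc c b y ⟨
  (c * b) * y   ∎)

module _ (ν κ : ℕ) where

  private
    2ν κ+ν : ℕ
    2ν = ν ℕ.+ ν
    κ+ν = κ ℕ.+ ν

  B₃₃-ratio : Ratio (den (+ ν)) (B ν κ 3 3) (r₃₃ (+ ν) (+ κ)) (B ν κ 5 4)
  B₃₃-ratio = ratio-trans (upper-step (3 ℕ.+ 2ν) (3 ℕ.+ κ+ν)) (absorption (4 ℕ.+ 2ν) (3 ℕ.+ κ+ν))

  B₄₃-ratio : Ratio (den (+ ν)) (B ν κ 4 3) (r₄₃ (+ ν) (+ κ)) (B ν κ 5 4)
  B₄₃-ratio = ratio-scaleʳ (+ (4 ℕ.+ 2ν)) (absorption (4 ℕ.+ 2ν) (3 ℕ.+ κ+ν))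

  B₄₄-ratio : Ratio (den (+ ν)) (B ν κ 4 4) (r₄₄ (+ ν) (+ κ)) (B ν κ 5 4)
  B₄₄-ratio = ratio-scaleʳ (+ (4 ℕ.+ 2ν)) (upper-step (4 ℕ.+ 2ν) (4 ℕ.+ κ+ν))

  B₅₅-ratio : Ratio (+ (5 ℕ.+ κ+ν)) (B ν κ 5 5) (+ (5 ℕ.+ 2ν) - + (4 ℕ.+ κ+ν)) (B ν κ 5 4)
  B₅₅-ratio = lower-step (5 ℕ.+ 2ν) (4 ℕ.+ κ+ν)

  B-suc : B (suc ν) κ 3 3 ≡ B ν κ 5 4
  B-suc = cong₂ binomial (cong (4 ℕ.+_) (ℕP.+-suc ν ν)) (cong (3 ℕ.+_) (ℕP.+-suc κ ν))

-- Clearing the denominators of a combination of products x·y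

record BilinearTerm (dx dy X Y : ℤ) : Set where
  constructor term
  field
    coefficient : ℤ
    {x x-ratio y y-ratio} : ℤ
    x-relation : Ratio dx x x-ratio X
    y-relation : Ratio dy y y-ratio Y

module _ {dx dy X Y : ℤ} where

  open BilinearTerm

  combination : List (BilinearTerm dx dy X Y) → ℤ
  combination []       = 0ℤ
  combination (t ∷ ts) = coefficient t * (x t * y t) + combination ts

  ratios : List (BilinearTerm dx dy X Y) → List (ℤ × ℤ × ℤ)
  ratios = map λ t → coefficient t , x-ratio t , y-ratio t

  clear-denominators : ∀ ts → dx * dy * combination ts ≡ Σ-triples (ratios ts) * (X * Y)
  clear-denominators []       = trans (ℤP.*-zeroʳ (dx * dy)) (sym (ℤP.*-zeroˡ (X * Y)))
  clear-denominators (term a {x} {rx} {y} {ry} (ratio p) (ratio q) ∷ ts) = begin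
    dx * dy * (a * (x * y) + combination ts)
      ≡⟨ distribute dx dy a x y (combination ts) ⟩
    a * ((dx * x) * (dy * y)) + dx * dy * combination ts
      ≡⟨ cong₂ (λ u v → a * (u * v) + dx * dy * combination ts) p q ⟩
    a * ((rx * X) * (ry * Y)) + dx * dy * combination ts
      ≡⟨ cong (λ s → a * ((rx * X) * (ry * Y)) + s) (clear-denominators ts) ⟩
    a * ((rx * X) * (ry * Y)) + Σ-triples (ratios ts) * (X * Y)
      ≡⟨ collect a rx ry X Y (Σ-triples (ratios ts)) ⟩
    (a * rx * ry + Σ-triples (ratios ts)) * (X * Y) ∎
    where
    distribute : ∀ dx dy a x y c → dx * dy * (a * (x * y) + c) ≡ a * ((dx * x) * (dy * y)) + dx * dy * c
    distribute = solve-∀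
    collect : ∀ a rx ry X Y s → a * ((rx * X) * (ry * Y)) + s * (X * Y) ≡ (a * rx * ry + s) * (X * Y)
    collect = solve-∀

  combination-vanishes : ∀ ts .{{_ : ℤ.NonZero (dx * dy)}} → Σ-triples (ratios ts) ≡ 0ℤ → combination ts ≡ 0ℤ
  combination-vanishes ts Σ≡0 = ℤP.*-cancelˡ-≡ (dx * dy) (combination ts) 0ℤ (begin
    dx * dy * combination ts          ≡⟨ clear-denominators ts ⟩
    Σ-triples (ratios ts) * (X * Y)   ≡⟨ cong (_* (X * Y)) Σ≡0 ⟩
    0ℤ                                ≡⟨ ℤP.*-zeroʳ (dx * dy) ⟨
    dx * dy * 0ℤ                      ∎)

signℤ : ℕ → ℤ
signℤ zero    = 1ℤ
signℤ (suc k) = - signℤ k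

sumToℤ : ℕ → (ℕ → ℤ) → ℤ
sumToℤ zero    f = f 0
sumToℤ (suc n) f = sumToℤ n f + f (suc n)

sum-cong : ∀ n {f g : ℕ → ℤ} → (∀ k → f k ≡ g k) → sumToℤ n f ≡ sumToℤ n g
sum-cong zero    f≗g = f≗g 0
sum-cong (suc n) f≗g = cong₂ _+_ (sum-cong n f≗g) (f≗g (suc n))

sum-+ : ∀ n (f g : ℕ → ℤ) → sumToℤ n (λ k → f k + g k) ≡ sumToℤ n f + sumToℤ n g
sum-+ zero    f g = refl
sum-+ (suc n) f g = trans (cong (_+ (f (suc n) + g (suc n))) (sum-+ n f g))
                          (interchange (sumToℤ n f) (sumToℤ n g) (f (suc n)) (g (suc n)))
  where
  interchange : ∀ a b c d → a + b + (c + d) ≡ a + c + (b + d)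
  interchange = solve-∀

sum-- : ∀ n (f g : ℕ → ℤ) → sumToℤ n (λ k → f k - g k) ≡ sumToℤ n f - sumToℤ n g
sum-- zero    f g = refl
sum-- (suc n) f g = trans (cong (_+ (f (suc n) - g (suc n))) (sum-- n f g))
                          (interchange (sumToℤ n f) (sumToℤ n g) (f (suc n)) (g (suc n)))
  where
  interchange : ∀ a b c d → a - b + (c - d) ≡ a + c - (b + d)
  interchange = solve-∀

sum-* : ∀ n c (f : ℕ → ℤ) → sumToℤ n (λ k → c * f k) ≡ c * sumToℤ n f
sum-* zero    c f = refl
sum-* (suc n) c f = trans (cong (_+ c * f (suc n)) (sum-* n c f))
                          (sym (ℤP.*-distribˡ-+ c (sumToℤ n f) (f (suc n))))

sum-linear : ∀ n a b (f g : ℕ → ℤ) → sumToℤ n (λ k → a * f k + b * g k) ≡ a * sumToℤ n f + b * sumToℤ n g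
sum-linear n a b f g = trans (sum-+ n (λ k → a * f k) (λ k → b * g k)) (cong₂ _+_ (sum-* n a f) (sum-* n b g))

sum-linear₃ : ∀ n a b c (f g h : ℕ → ℤ) →
  sumToℤ n (λ k → a * f k + b * g k + c * h k) ≡ a * sumToℤ n f + b * sumToℤ n g + c * sumToℤ n h
sum-linear₃ n a b c f g h =
  trans (sum-+ n (λ k → a * f k + b * g k) (λ k → c * h k)) (cong₂ _+_ (sum-linear n a b f g) (sum-* n c h))

telescope : ∀ n (f : ℕ → ℤ) → sumToℤ n (λ k → f (suc k) - f k) ≡ f (suc n) - f 0
telescope zero    f = refl
telescope (suc n) f = trans (cong (_+ (f (2 ℕ.+ n) - f (suc n))) (telescope n f))
                            (collapse (f (2 ℕ.+ n)) (f (suc n)) (f 0))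
  where
  collapse : ∀ a b c → b - c + (a - b) ≡ a - c
  collapse = solve-∀

sum-shift : ∀ n (f : ℕ → ℤ) → sumToℤ (suc n) f ≡ f 0 + sumToℤ n (f ∘ suc)
sum-shift zero    f = refl
sum-shift (suc n) f = trans (cong (_+ f (2 ℕ.+ n)) (sum-shift n f)) (ℤP.+-assoc (f 0) _ _)

sum-extend : ∀ a b (f : ℕ → ℤ) → (∀ j → a < j → f j ≡ 0ℤ) → sumToℤ (a ℕ.+ b) f ≡ sumToℤ a f
sum-extend a zero    f tail = cong (λ x → sumToℤ x f) (ℕP.+-identityʳ a)
sum-extend a (suc b) f tail = begin
  sumToℤ (a ℕ.+ suc b) f                   ≡⟨ cong (λ x → sumToℤ x f) (ℕP.+-suc a b) ⟩
  sumToℤ (a ℕ.+ b) f + f (suc (a ℕ.+ b))   ≡⟨ cong₂ _+_ (sum-extend a b f tail)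
                                                        (tail (suc (a ℕ.+ b)) (s≤s (ℕP.m≤m+n a b))) ⟩
  sumToℤ a f + 0ℤ                          ≡⟨ ℤP.+-identityʳ (sumToℤ a f) ⟩
  sumToℤ a f                               ∎

-- The two telescoping recurrences for σ

-- C(2n+3, n+k+3) equals C(2n+3, n-k) for k ≤ n but, unlike it, vanishes for k > n, so the
-- telescoping identities below hold for every k.
τ : ℕ → ℕ → ℕ → ℤ
τ n m k = signℤ k * w (+ k) * (B n k 3 3 * B m k 3 3)

σ : ℕ → ℕ → ℤ
σ n m = sumToℤ n (τ n m)

σ-extend : ∀ n m → sumToℤ (suc n) (τ n m) ≡ σ n m
σ-extend n m = trans (cong (λ t → σ n m + t) τ-beyond) (ℤP.+-identityʳ (σ n m))
  where
  τ-beyond : τ n m (suc n) ≡ 0ℤ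
  τ-beyond = trans (cong (λ b → signℤ (suc n) * w (+ suc n) * (b * B m (suc n) 3 3))
                         (binomial-below (ℕP.n<1+n (3 ℕ.+ (n ℕ.+ n)))))
                   (ℤP.*-zeroʳ (signℤ (suc n) * w (+ suc n)))

base-antidifference : ℕ → ℕ → ℤ
base-antidifference n k = signℤ k * H (+ n) (+ k) * (B n k 4 3 * B (suc n) k 4 3)

base-terms : ∀ n k → List (BilinearTerm (den (+ n)) (den (+ suc n)) (B n k 5 4) (B (suc n) k 5 4))
base-terms n k =
  term (c₀ (+ n) * (1ℤ + + n) * w (+ k)) (ratio-≡ (B-suc n k)) (ratio-≡ (B-suc (suc n) k)) ∷
  term (- (c₀ (+ n) * (+ 2 * (+ 7 + (+ n + + n))) * w (+ k))) (B₃₃-ratio n k) (B₃₃-ratio (suc n) k) ∷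
  term (H (+ n) (+ suc k)) (B₄₄-ratio n k) (B₄₄-ratio (suc n) k) ∷
  term (H (+ n) (+ k)) (B₄₃-ratio n k) (B₄₃-ratio (suc n) k) ∷ []

base-telescoping : ∀ n k →
  c₀ (+ n) * ((1ℤ + + n) * τ (suc n) (2 ℕ.+ n) k - + 2 * (+ 7 + (+ n + + n)) * τ n (suc n) k)
    ≡ base-antidifference n (suc k) - base-antidifference n k
base-telescoping n k = ℤP.i-j≡0⇒i≡j _ _ (begin
  _ ≡⟨ rearrange (signℤ k) (c₀ (+ n)) (1ℤ + + n) (+ 2 * (+ 7 + (+ n + + n))) (w (+ k))
                 (H (+ n) (+ suc k)) (H (+ n) (+ k)) _ _ _ _ ⟩
  signℤ k * combination (base-terms n k)
    ≡⟨ cong (signℤ k *_) (combination-vanishes (base-terms n k) (Σ-base-ratios≡0 (+ n) (+ k))) ⟩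
  signℤ k * 0ℤ
    ≡⟨ ℤP.*-zeroʳ (signℤ k) ⟩
  0ℤ ∎)
  where
  rearrange : ∀ s c p q w H′ H u₁ u₂ u₃ u₄ →
    c * (p * (s * w * u₁) - q * (s * w * u₂)) - ((- s) * H′ * u₃ - s * H * u₄)
      ≡ s * (c * p * w * u₁ + (- (c * q * w) * u₂ + (H′ * u₃ + (H * u₄ + 0ℤ))))
  rearrange = solve-∀

recurrence-antidifference : ℕ → ℕ → ℕ → ℤ
recurrence-antidifference n d k = signℤ k * G (+ n) (+ d) (+ k) * (B n k 4 3 * B (suc (n ℕ.+ d)) k 5 4)

recurrence-terms : ∀ n d k → let M = suc (n ℕ.+ d) in
  List (BilinearTerm (den (+ n)) (den (+ M) * + (5 ℕ.+ (k ℕ.+ M))) (B n k 5 4) (B M k 5 4))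
recurrence-terms n d k =
  term (+ 2 * c₁ (+ n) (+ d) * w (+ k)) (B₃₃-ratio n k) (ratio-≡ (B-suc M k)) ∷
  term (+ 2 * c₂ (+ n) (+ d) * w (+ k)) (B₃₃-ratio n k) (ratio-scaleʳ (+ (5 ℕ.+ (k ℕ.+ M))) (B₃₃-ratio M k)) ∷
  term (+ 2 * c₃ (+ n) (+ d) * w (+ k)) (ratio-≡ (B-suc n k)) (ratio-scaleʳ (+ (5 ℕ.+ (k ℕ.+ M))) (B₃₃-ratio M k)) ∷
  term (G (+ n) (+ d) (+ suc k)) (B₄₄-ratio n k) (ratio-scaleˡ (den (+ M)) (B₅₅-ratio M k)) ∷
  term (G (+ n) (+ d) (+ k)) (B₄₃-ratio n k) (ratio-≡ refl) ∷ []
  where M = suc (n ℕ.+ d)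

recurrence-telescoping : ∀ n d k → let M = suc (n ℕ.+ d) in
  + 2 * (c₁ (+ n) (+ d) * τ n (suc M) k + c₂ (+ n) (+ d) * τ n M k + c₃ (+ n) (+ d) * τ (suc n) M k)
    ≡ recurrence-antidifference n d (suc k) - recurrence-antidifference n d k
recurrence-telescoping n d k = ℤP.i-j≡0⇒i≡j _ _ (begin
  _ ≡⟨ rearrange (signℤ k) (c₁ (+ n) (+ d)) (c₂ (+ n) (+ d)) (c₃ (+ n) (+ d)) (w (+ k))
                 (G (+ n) (+ d) (+ suc k)) (G (+ n) (+ d) (+ k)) _ _ _ _ _ ⟩
  signℤ k * combination (recurrence-terms n d k)
    ≡⟨ cong (signℤ k *_) (combination-vanishes (recurrence-terms n d k) (Σ-recurrence-ratios≡0 (+ n) (+ d) (+ k))) ⟩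
  signℤ k * 0ℤ
    ≡⟨ ℤP.*-zeroʳ (signℤ k) ⟩
  0ℤ ∎)
  where
  rearrange : ∀ s c₁ c₂ c₃ w G′ G u₁ u₂ u₃ u₄ u₅ →
    + 2 * (c₁ * (s * w * u₁) + c₂ * (s * w * u₂) + c₃ * (s * w * u₃)) - ((- s) * G′ * u₄ - s * G * u₅)
      ≡ s * (+ 2 * c₁ * w * u₁ + (+ 2 * c₂ * w * u₂ + (+ 2 * c₃ * w * u₃ + (G′ * u₄ + (G * u₅ + 0ℤ)))))
  rearrange = solve-∀

σ-diagonal-recurrence : ∀ n → (1ℤ + + n) * σ (suc n) (2 ℕ.+ n) ≡ + 2 * (+ 7 + (+ n + + n)) * σ n (suc n)
σ-diagonal-recurrence n = ℤP.i-j≡0⇒i≡j _ _ (ℤP.*-cancelˡ-≡ (c₀ (+ n)) _ 0ℤ (begin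
  c₀′ * (p * σ (suc n) (2 ℕ.+ n) - q * σ n (suc n))
    ≡⟨ cong (λ u → c₀′ * (p * σ (suc n) (2 ℕ.+ n) - q * u)) (σ-extend n (suc n)) ⟨
  c₀′ * (p * sumToℤ (suc n) τ₁ - q * sumToℤ (suc n) τ₂)
    ≡⟨ cong₂ (λ u v → c₀′ * (u - v)) (sum-* (suc n) p τ₁) (sum-* (suc n) q τ₂) ⟨
  c₀′ * (sumToℤ (suc n) (λ k → p * τ₁ k) - sumToℤ (suc n) (λ k → q * τ₂ k))
    ≡⟨ cong (c₀′ *_) (sum-- (suc n) _ _) ⟨
  c₀′ * sumToℤ (suc n) (λ k → p * τ₁ k - q * τ₂ k)
    ≡⟨ sum-* (suc n) c₀′ _ ⟨
  sumToℤ (suc n) (λ k → c₀′ * (p * τ₁ k - q * τ₂ k))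
    ≡⟨ sum-cong (suc n) (base-telescoping n) ⟩
  sumToℤ (suc n) (λ k → base-antidifference n (suc k) - base-antidifference n k)
    ≡⟨ telescope (suc n) (base-antidifference n) ⟩
  base-antidifference n (2 ℕ.+ n) - 0ℤ
    ≡⟨ cong (_- 0ℤ) beyond ⟩
  0ℤ
    ≡⟨ ℤP.*-zeroʳ c₀′ ⟨
  c₀′ * 0ℤ ∎))
  where
  c₀′ = c₀ (+ n)
  p = 1ℤ + + n
  q = + 2 * (+ 7 + (+ n + + n))
  τ₁ = τ (suc n) (2 ℕ.+ n)
  τ₂ = τ n (suc n)
  beyond : base-antidifference n (2 ℕ.+ n) ≡ 0ℤ
  beyond = trans (cong (λ b → signℤ (2 ℕ.+ n) * H (+ n) (+ (2 ℕ.+ n)) * (b * B (suc n) (2 ℕ.+ n) 4 3))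
                       (binomial-below (ℕP.n<1+n (4 ℕ.+ (n ℕ.+ n)))))
                 (ℤP.*-zeroʳ (signℤ (2 ℕ.+ n) * H (+ n) (+ (2 ℕ.+ n))))

σ-recurrence : ∀ n d → let M = suc (n ℕ.+ d) in
  c₁ (+ n) (+ d) * σ n (suc M) + c₂ (+ n) (+ d) * σ n M + c₃ (+ n) (+ d) * σ (suc n) M ≡ 0ℤ
σ-recurrence n d = ℤP.*-cancelˡ-≡ (+ 2) _ 0ℤ (begin
  + 2 * (c₁′ * σ n (suc M) + c₂′ * σ n M + c₃′ * σ (suc n) M)
    ≡⟨ cong₂ (λ u v → + 2 * (c₁′ * u + c₂′ * v + c₃′ * σ (suc n) M)) (σ-extend n (suc M)) (σ-extend n M) ⟨
  + 2 * (c₁′ * sumToℤ (suc n) τ₁ + c₂′ * sumToℤ (suc n) τ₂ + c₃′ * sumToℤ (suc n) τ₃)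
    ≡⟨ cong (+ 2 *_) (sum-linear₃ (suc n) c₁′ c₂′ c₃′ τ₁ τ₂ τ₃) ⟨
  + 2 * sumToℤ (suc n) (λ k → c₁′ * τ₁ k + c₂′ * τ₂ k + c₃′ * τ₃ k)
    ≡⟨ sum-* (suc n) (+ 2) _ ⟨
  sumToℤ (suc n) (λ k → + 2 * (c₁′ * τ₁ k + c₂′ * τ₂ k + c₃′ * τ₃ k))
    ≡⟨ sum-cong (suc n) (recurrence-telescoping n d) ⟩
  sumToℤ (suc n) (λ k → recurrence-antidifference n d (suc k) - recurrence-antidifference n d k)
    ≡⟨ telescope (suc n) (recurrence-antidifference n d) ⟩
  recurrence-antidifference n d (2 ℕ.+ n) - 0ℤ
    ≡⟨ cong (_- 0ℤ) beyond ⟩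
  0ℤ ∎)
  where
  M = suc (n ℕ.+ d)
  c₁′ = c₁ (+ n) (+ d)
  c₂′ = c₂ (+ n) (+ d)
  c₃′ = c₃ (+ n) (+ d)
  τ₁ = τ n (suc M)
  τ₂ = τ n M
  τ₃ = τ (suc n) M
  beyond : recurrence-antidifference n d (2 ℕ.+ n) ≡ 0ℤ
  beyond = trans (cong (λ b → signℤ (2 ℕ.+ n) * G (+ n) (+ d) (+ (2 ℕ.+ n)) * (b * B M (2 ℕ.+ n) 5 4))
                       (binomial-below (ℕP.n<1+n (4 ℕ.+ (n ℕ.+ n)))))
                 (ℤP.*-zeroʳ (signℤ (2 ℕ.+ n) * G (+ n) (+ d) (+ (2 ℕ.+ n))))

-- Solving the recurrences

catalanℤ : ℕ → ℤ
catalanℤ j = binomial (j ℕ.+ j) j - binomial (j ℕ.+ j) (suc j)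

catalanℤ-central : ∀ j → (1ℤ + + j) * catalanℤ j ≡ binomial (j ℕ.+ j) j
catalanℤ-central j = begin
  (1ℤ + + j) * (a - b)                    ≡⟨ distribute (+ j) a b ⟩
  (1ℤ + + j) * a - (1ℤ + + j) * b         ≡⟨ cong (λ t → (1ℤ + + j) * a - t) (Ratio.cross (lower-step (j ℕ.+ j) j)) ⟩
  (1ℤ + + j) * a - (+ j + + j - + j) * a  ≡⟨ collapse (+ j) a ⟩
  a                                       ∎
  where
  a = binomial (j ℕ.+ j) j
  b = binomial (j ℕ.+ j) (suc j)
  distribute : ∀ j a b → (1ℤ + j) * (a - b) ≡ (1ℤ + j) * a - (1ℤ + j) * b
  distribute = solve-∀
  collapse : ∀ j a → (1ℤ + j) * a - (j + j - j) * a ≡ a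
  collapse = solve-∀

central-binomial-step : ∀ j →
  (1ℤ + + j) * binomial (2 ℕ.+ (j ℕ.+ j)) (suc j) ≡ + 2 * (1ℤ + (+ j + + j)) * binomial (j ℕ.+ j) j
central-binomial-step j = ℤP.*-cancelˡ-≡ (1ℤ + + j) _ _ (begin
  (1ℤ + + j) * ((1ℤ + + j) * b₂)
    ≡⟨ cong ((1ℤ + + j) *_) (Ratio.cross (absorption (suc (j ℕ.+ j)) j)) ⟨
  (1ℤ + + j) * ((+ 2 + (+ j + + j)) * b₁)
    ≡⟨ regroup (+ j) b₁ ⟩
  (+ 2 + (+ j + + j)) * ((1ℤ + (+ j + + j) - + j) * b₁)
    ≡⟨ cong ((+ 2 + (+ j + + j)) *_) (Ratio.cross (upper-step (j ℕ.+ j) j)) ⟨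
  (+ 2 + (+ j + + j)) * ((1ℤ + (+ j + + j)) * b₀)
    ≡⟨ regroup′ (+ j) b₀ ⟩
  (1ℤ + + j) * (+ 2 * (1ℤ + (+ j + + j)) * b₀) ∎)
  where
  b₀ = binomial (j ℕ.+ j) j
  b₁ = binomial (suc (j ℕ.+ j)) j
  b₂ = binomial (2 ℕ.+ (j ℕ.+ j)) (suc j)
  regroup : ∀ j c → (1ℤ + j) * ((+ 2 + (j + j)) * c) ≡ (+ 2 + (j + j)) * ((1ℤ + (j + j) - j) * c)
  regroup = solve-∀
  regroup′ : ∀ j c → (+ 2 + (j + j)) * ((1ℤ + (j + j)) * c) ≡ (1ℤ + j) * (+ 2 * (1ℤ + (j + j)) * c)
  regroup′ = solve-∀

catalanℤ-recurrence : ∀ j → (+ 2 + + j) * catalanℤ (suc j) ≡ + 2 * (1ℤ + (+ j + + j)) * catalanℤ j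
catalanℤ-recurrence j = ℤP.*-cancelˡ-≡ (1ℤ + + j) _ _ (begin
  (1ℤ + + j) * ((+ 2 + + j) * catalanℤ (suc j))
    ≡⟨ cong ((1ℤ + + j) *_) (trans (catalanℤ-central (suc j)) (cong (λ i → binomial i (suc j)) (ℕP.+-suc (suc j) j))) ⟩
  (1ℤ + + j) * binomial (2 ℕ.+ (j ℕ.+ j)) (suc j)
    ≡⟨ central-binomial-step j ⟩
  + 2 * (1ℤ + (+ j + + j)) * binomial (j ℕ.+ j) j
    ≡⟨ cong (+ 2 * (1ℤ + (+ j + + j)) *_) (catalanℤ-central j) ⟨
  + 2 * (1ℤ + (+ j + + j)) * ((1ℤ + + j) * catalanℤ j)
    ≡⟨ swap (+ 2 * (1ℤ + (+ j + + j))) (1ℤ + + j) (catalanℤ j) ⟩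
  (1ℤ + + j) * (+ 2 * (1ℤ + (+ j + + j)) * catalanℤ j) ∎)
  where
  swap : ∀ a b c → a * (b * c) ≡ b * (a * c)
  swap = solve-∀

diagonal : ℕ → ℤ
diagonal n = P (+ n) * P (+ suc n) * catalanℤ (suc n)

diagonal-recurrence : ∀ n → (1ℤ + + n) * diagonal (suc n) ≡ + 2 * (+ 7 + (+ n + + n)) * diagonal n
diagonal-recurrence n = begin
  (1ℤ + + n) * (P (+ suc n) * P (+ 2 + + n) * catalanℤ (2 ℕ.+ n))
    ≡⟨ cong (λ t → (1ℤ + + n) * (P (+ suc n) * t * catalanℤ (2 ℕ.+ n))) (P-shift (+ n)) ⟩
  (1ℤ + + n) * (P (+ suc n) * ((+ 3 + + n) * (+ 7 + (+ n + + n))) * catalanℤ (2 ℕ.+ n))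
    ≡⟨ regroup (1ℤ + + n) (P (+ suc n)) (+ 3 + + n) (+ 7 + (+ n + + n)) (catalanℤ (2 ℕ.+ n)) ⟩
  (1ℤ + + n) * P (+ suc n) * (+ 7 + (+ n + + n)) * ((+ 3 + + n) * catalanℤ (2 ℕ.+ n))
    ≡⟨ cong ((1ℤ + + n) * P (+ suc n) * (+ 7 + (+ n + + n)) *_) catalan-step ⟩
  (1ℤ + + n) * P (+ suc n) * (+ 7 + (+ n + + n)) * (+ 2 * (+ 3 + (+ n + + n)) * catalanℤ (suc n))
    ≡⟨ regroup′ (1ℤ + + n) (P (+ suc n)) (+ 7 + (+ n + + n)) (+ 3 + (+ n + + n)) (catalanℤ (suc n)) ⟩
  + 2 * (+ 7 + (+ n + + n)) * ((1ℤ + + n) * (+ 3 + (+ n + + n)) * P (+ suc n) * catalanℤ (suc n)) ∎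
  where
  P-shift : ∀ n → (1ℤ + (+ 2 + n)) * (+ 3 + ((+ 2 + n) + (+ 2 + n))) ≡ (+ 3 + n) * (+ 7 + (n + n))
  P-shift = solve-∀
  catalan-step : (+ 3 + + n) * catalanℤ (2 ℕ.+ n) ≡ + 2 * (+ 3 + (+ n + + n)) * catalanℤ (suc n)
  catalan-step = trans (catalanℤ-recurrence (suc n))
                       (cong (λ i → + 2 * + i * catalanℤ (suc n)) (cong (2 ℕ.+_) (ℕP.+-suc n n)))
  regroup : ∀ a p b e c → a * (p * (b * e) * c) ≡ a * p * e * (b * c)
  regroup = solve-∀
  regroup′ : ∀ a p e f c → a * p * e * (+ 2 * f * c) ≡ + 2 * e * (a * f * p * c)
  regroup′ = solve-∀

σ-diagonal : ∀ n → σ n (suc n) ≡ diagonal n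
σ-diagonal zero    = refl
σ-diagonal (suc n) = ℤP.*-cancelˡ-≡ (1ℤ + + n) _ _ (begin
  (1ℤ + + n) * σ (suc n) (2 ℕ.+ n)           ≡⟨ σ-diagonal-recurrence n ⟩
  + 2 * (+ 7 + (+ n + + n)) * σ n (suc n)    ≡⟨ cong (+ 2 * (+ 7 + (+ n + + n)) *_) (σ-diagonal n) ⟩
  + 2 * (+ 7 + (+ n + + n)) * diagonal n     ≡⟨ diagonal-recurrence n ⟨
  (1ℤ + + n) * diagonal (suc n)              ∎)

F : ℕ → ℕ → ℤ
F n zero          = 0ℤ
F n (suc zero)    = catalanℤ (suc n)
F n (suc (suc d)) = + 4 * F n (suc d) - F (suc n) d

-- Instantiated with aᵢ = P(n+i), bᵢ = P(n+d+i), the three values of σ in σ-recurrence and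
-- f₁ = F(n,d+1), f₂ = F(n+1,d), this is the inductive step of σ-closed-form.
closed-form-step : ∀ d a₀ a₁ b₁ b₂ x y z f₁ f₂ .{{_ : ℤ.NonZero (a₁ * b₁)}} →
  (+ 2 + d) * a₁ * b₁ * x + - (+ 4 * (1ℤ + d) * a₁ * b₂) * y + d * a₀ * b₂ * z ≡ 0ℤ →
  (1ℤ + d) * y ≡ a₀ * b₁ * f₁ →
  d * z ≡ a₁ * b₁ * f₂ →
  (+ 2 + d) * x ≡ a₀ * b₂ * (+ 4 * f₁ - f₂)
closed-form-step d a₀ a₁ b₁ b₂ x y z f₁ f₂ r h₁ h₂ =
  ℤP.*-cancelˡ-≡ (a₁ * b₁) _ _ (ℤP.i-j≡0⇒i≡j _ _ (begin
    a₁ * b₁ * ((+ 2 + d) * x) - a₁ * b₁ * (a₀ * b₂ * (+ 4 * f₁ - f₂))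
      ≡⟨ combine d a₀ a₁ b₁ b₂ x y z f₁ f₂ ⟩
    ((+ 2 + d) * a₁ * b₁ * x + - (+ 4 * (1ℤ + d) * a₁ * b₂) * y + d * a₀ * b₂ * z)
      + + 4 * a₁ * b₂ * ((1ℤ + d) * y - a₀ * b₁ * f₁) - a₀ * b₂ * (d * z - a₁ * b₁ * f₂)
      ≡⟨ cong₃ (λ u v t → u + + 4 * a₁ * b₂ * v - a₀ * b₂ * t)
               r (ℤP.i≡j⇒i-j≡0 h₁) (ℤP.i≡j⇒i-j≡0 h₂) ⟩
    0ℤ + + 4 * a₁ * b₂ * 0ℤ - a₀ * b₂ * 0ℤ
      ≡⟨ vanish (+ 4 * a₁ * b₂) (a₀ * b₂) ⟩
    0ℤ ∎))
  where
  combine : ∀ d a₀ a₁ b₁ b₂ x y z f₁ f₂ →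
    a₁ * b₁ * ((+ 2 + d) * x) - a₁ * b₁ * (a₀ * b₂ * (+ 4 * f₁ - f₂))
      ≡ ((+ 2 + d) * a₁ * b₁ * x + - (+ 4 * (1ℤ + d) * a₁ * b₂) * y + d * a₀ * b₂ * z)
        + + 4 * a₁ * b₂ * ((1ℤ + d) * y - a₀ * b₁ * f₁) - a₀ * b₂ * (d * z - a₁ * b₁ * f₂)
  combine = solve-∀
  vanish : ∀ a b → 0ℤ + a * 0ℤ - b * 0ℤ ≡ 0ℤ
  vanish = solve-∀

σ-closed-form : ∀ d n → + d * σ n (n ℕ.+ d) ≡ P (+ n) * P (+ (n ℕ.+ d)) * F n d
σ-closed-form zero n = sym (ℤP.*-zeroʳ (P (+ n) * P (+ (n ℕ.+ 0))))
σ-closed-form (suc zero) n = begin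
  1ℤ * σ n (n ℕ.+ 1)                           ≡⟨ ℤP.*-identityˡ _ ⟩
  σ n (n ℕ.+ 1)                                ≡⟨ cong (σ n) (ℕP.+-comm n 1) ⟩
  σ n (suc n)                                  ≡⟨ σ-diagonal n ⟩
  P (+ n) * P (+ suc n) * catalanℤ (suc n)     ≡⟨ cong (λ m → P (+ n) * P (+ m) * catalanℤ (suc n)) (ℕP.+-comm 1 n) ⟩
  P (+ n) * P (+ (n ℕ.+ 1)) * catalanℤ (suc n) ∎
σ-closed-form (suc (suc d)) n =
  subst (λ m → + suc (suc d) * σ n m ≡ P (+ n) * P (+ m) * F n (suc (suc d)))
        (sym (trans (ℕP.+-suc n (suc d)) (cong suc (ℕP.+-suc n d))))
        (closed-form-step (+ d) (P (+ n)) (P (+ suc n)) (P (+ M)) (P (+ suc M))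
                          (σ n (suc M)) (σ n M) (σ (suc n) M) (F n (suc d)) (F (suc n) d)
                          (σ-recurrence n d)
                          (subst (λ m → + suc d * σ n m ≡ P (+ n) * P (+ m) * F n (suc d))
                                 (ℕP.+-suc n d) (σ-closed-form (suc d) n))
                          (σ-closed-form d (suc n)))
  where M = suc (n ℕ.+ d)

-- The right-hand side

ρ : ℕ → ℕ → ℕ → ℤ
ρ n e j = signℤ j * binomial (e ∸ j) j * catalanℤ (n ℕ.+ j ℕ.+ 1) * + (4 ^ (e ∸ 2 ℕ.* j))

S : ℕ → ℕ → ℤ
S n e = sumToℤ e (ρ n e)

ρ-vanishes : ∀ n e j → e < j ℕ.+ j → ρ n e j ≡ 0ℤ
ρ-vanishes n e (suc j) e<2j = begin
  signℤ (suc j) * binomial (e ∸ suc j) (suc j) * c * p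
    ≡⟨ cong (λ b → signℤ (suc j) * b * c * p) (binomial-below (ℕP.m<n+o⇒m∸n<o e (suc j) e<2j)) ⟩
  signℤ (suc j) * 0ℤ * c * p
    ≡⟨ cong (λ t → t * c * p) (ℤP.*-zeroʳ (signℤ (suc j))) ⟩
  0ℤ ∎
  where
  c = catalanℤ (n ℕ.+ suc j ℕ.+ 1)
  p = + (4 ^ (e ∸ 2 ℕ.* suc j))

pascal∸ : ∀ e i → binomial (suc e ∸ i) (suc i) ≡ binomial (e ∸ i) i + binomial (e ∸ i) (suc i)
pascal∸ e i with i ℕP.≤? e
... | yes i≤e = trans (cong (λ a → binomial a (suc i)) (ℕP.+-∸-assoc 1 i≤e)) (pascal (e ∸ i) i)
... | no  i≰e = trans (binomial-below (ℕP.≤-<-trans (ℕP.m∸n≤m (suc e) i) (s≤s e<i)))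
                      (sym (cong₂ _+_ (binomial-below e∸i<i) (binomial-below (ℕP.m<n⇒m<1+n e∸i<i))))
  where
  e<i = ℕP.≰⇒> i≰e
  e∸i<i = ℕP.≤-<-trans (ℕP.m∸n≤m e i) e<i

∸-suc : ∀ {m n} → m < n → n ∸ m ≡ suc (n ∸ suc m)
∸-suc {zero}  {suc n} _         = refl
∸-suc {suc m} {suc n} (s≤s m<n) = ∸-suc m<n

power-step : ∀ e i → let b = binomial (e ∸ i) (suc i) in
  b * + (4 ^ (e ∸ 2 ℕ.* i)) ≡ + 4 * (b * + (4 ^ (e ∸ suc (2 ℕ.* i))))
power-step e i with 2 ℕ.* i ℕP.<? e
... | yes 2i<e = begin
  b * + (4 ^ (e ∸ 2 ℕ.* i))                 ≡⟨ cong (λ x → b * + (4 ^ x)) (∸-suc 2i<e) ⟩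
  b * + (4 ℕ.* 4 ^ (e ∸ suc (2 ℕ.* i)))      ≡⟨ cong (b *_) (ℤP.pos-* 4 (4 ^ (e ∸ suc (2 ℕ.* i)))) ⟩
  b * (+ 4 * + (4 ^ (e ∸ suc (2 ℕ.* i))))    ≡⟨ swap b (+ 4) _ ⟩
  + 4 * (b * + (4 ^ (e ∸ suc (2 ℕ.* i))))    ∎
  where
  b = binomial (e ∸ i) (suc i)
  swap : ∀ a b c → a * (b * c) ≡ b * (a * c)
  swap = solve-∀
... | no 2i≮e = trans (cong (_* + (4 ^ (e ∸ 2 ℕ.* i))) empty)
                      (cong (λ b → + 4 * (b * + (4 ^ (e ∸ suc (2 ℕ.* i))))) (sym empty))
  where
  e≤i+i : e ≤ i ℕ.+ i
  e≤i+i = subst (e ≤_) (cong (i ℕ.+_) (ℕP.+-identityʳ i)) (ℕP.≮⇒≥ 2i≮e)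
  empty : binomial (e ∸ i) (suc i) ≡ 0ℤ
  empty = binomial-below (s≤s (ℕP.m≤n+o⇒m∸n≤o e i e≤i+i))

ρ-step : ∀ n e i → ρ n (2 ℕ.+ e) (suc i) ≡ + 4 * ρ n (suc e) (suc i) - ρ (suc n) e i
ρ-step n e i = begin
  (- s) * binomial (suc e ∸ i) (suc i) * c * + (4 ^ (2 ℕ.+ e ∸ 2 ℕ.* suc i))
    ≡⟨ cong₂ (λ x y → (- s) * x * c * + (4 ^ y)) (pascal∸ e i) (cong (2 ℕ.+ e ∸_) (ℕP.*-suc 2 i)) ⟩
  (- s) * (a + b) * c * p
    ≡⟨ expand s a b c p ⟩
  (- s) * c * (b * p) - s * a * c * p
    ≡⟨ cong (λ t → (- s) * c * t - s * a * c * p) (power-step e i) ⟩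
  (- s) * c * (+ 4 * (b * q)) - s * a * c * p
    ≡⟨ regroup s b c q (s * a * c * p) ⟩
  + 4 * ((- s) * b * c * q) - s * a * c * p
    ≡⟨ cong₂ (λ x y → + 4 * ((- s) * b * c * + (4 ^ x)) - s * a * catalanℤ y * p)
             (sym (cong (suc e ∸_) (ℕP.*-suc 2 i))) (cong (ℕ._+ 1) (ℕP.+-suc n i)) ⟩
  + 4 * ρ n (suc e) (suc i) - ρ (suc n) e i ∎
  where
  s = signℤ i
  a = binomial (e ∸ i) i
  b = binomial (e ∸ i) (suc i)
  c = catalanℤ (n ℕ.+ suc i ℕ.+ 1)
  p = + (4 ^ (e ∸ 2 ℕ.* i))
  q = + (4 ^ (e ∸ suc (2 ℕ.* i)))
  expand : ∀ s a b c p → (- s) * (a + b) * c * p ≡ (- s) * c * (b * p) - s * a * c * p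
  expand = solve-∀
  regroup : ∀ s b c q r → (- s) * c * (+ 4 * (b * q)) - r ≡ + 4 * ((- s) * b * c * q) - r
  regroup = solve-∀

S-recurrence : ∀ n e → S n (2 ℕ.+ e) ≡ + 4 * S n (suc e) - S (suc n) e
S-recurrence n e = begin
  S n (2 ℕ.+ e)
    ≡⟨ sum-shift (suc e) (ρ n (2 ℕ.+ e)) ⟩
  ρ n (2 ℕ.+ e) 0 + sumToℤ (suc e) (λ i → ρ n (2 ℕ.+ e) (suc i))
    ≡⟨ cong₂ _+_ head (sum-cong (suc e) (ρ-step n e)) ⟩
  + 4 * ρ n (suc e) 0 + sumToℤ (suc e) (λ i → + 4 * ρ n (suc e) (suc i) - ρ (suc n) e i)
    ≡⟨ cong (λ t → + 4 * ρ n (suc e) 0 + t)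
            (trans (sum-- (suc e) _ (ρ (suc n) e)) (cong (_- S′) (sum-* (suc e) (+ 4) (λ i → ρ n (suc e) (suc i))))) ⟩
  + 4 * ρ n (suc e) 0 + (+ 4 * (tail + ρ n (suc e) (2 ℕ.+ e)) - (S (suc n) e + ρ (suc n) e (suc e)))
    ≡⟨ cong₂ (λ x y → + 4 * ρ n (suc e) 0 + (+ 4 * (tail + x) - (S (suc n) e + y)))
             (ρ-vanishes n (suc e) (2 ℕ.+ e) (below-double (ℕP.n<1+n (suc e))))
             (ρ-vanishes (suc n) e (suc e) (below-double (ℕP.n<1+n e))) ⟩
  + 4 * ρ n (suc e) 0 + (+ 4 * (tail + 0ℤ) - (S (suc n) e + 0ℤ))
    ≡⟨ collect (ρ n (suc e) 0) tail (S (suc n) e) ⟩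
  + 4 * (ρ n (suc e) 0 + tail) - S (suc n) e
    ≡⟨ cong (λ t → + 4 * t - S (suc n) e) (sum-shift e (ρ n (suc e))) ⟨
  + 4 * S n (suc e) - S (suc n) e ∎
  where
  tail = sumToℤ e (λ i → ρ n (suc e) (suc i))
  S′ = sumToℤ (suc e) (ρ (suc n) e)
  head : ρ n (2 ℕ.+ e) 0 ≡ + 4 * ρ n (suc e) 0
  head = trans (cong (1ℤ * 1ℤ * c *_) (ℤP.pos-* 4 (4 ^ suc e))) (swap (1ℤ * 1ℤ * c) (+ 4) (+ (4 ^ suc e)))
    where
    c = catalanℤ (n ℕ.+ 0 ℕ.+ 1)
    swap : ∀ a b c → a * (b * c) ≡ b * (a * c)
    swap = solve-∀
  below-double : ∀ {m k} → m < k → m < k ℕ.+ k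
  below-double {k = k} m<k = ℕP.<-≤-trans m<k (ℕP.m≤m+n k k)
  collect : ∀ r t s → + 4 * r + (+ 4 * (t + 0ℤ) - (s + 0ℤ)) ≡ + 4 * (r + t) - s
  collect = solve-∀

n+0+1≡1+n : ∀ n → n ℕ.+ 0 ℕ.+ 1 ≡ suc n
n+0+1≡1+n n = trans (cong (ℕ._+ 1) (ℕP.+-identityʳ n)) (ℕP.+-comm n 1)

S≡F : ∀ e n → S n e ≡ F n (suc e)
S≡F zero n = trans (unit (catalanℤ (n ℕ.+ 0 ℕ.+ 1))) (cong catalanℤ (n+0+1≡1+n n))
  where
  unit : ∀ c → 1ℤ * 1ℤ * c * 1ℤ ≡ c
  unit = solve-∀
S≡F (suc zero) n = trans (four (catalanℤ (n ℕ.+ 0 ℕ.+ 1))) (cong (λ i → + 4 * catalanℤ i - 0ℤ) (n+0+1≡1+n n))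
  where
  four : ∀ c → 1ℤ * 1ℤ * c * + 4 + 0ℤ ≡ + 4 * c - 0ℤ
  four = solve-∀
S≡F (suc (suc e)) n = trans (S-recurrence n e) (cong₂ (λ a b → + 4 * a - b) (S≡F (suc e) n) (S≡F e (suc n)))

half-bound : ∀ e j → e / 2 < j → e < j ℕ.+ j
half-bound e j e/2<j = ℕP.<-≤-trans e<2+h*2 (subst (ℕ._≤ j ℕ.+ j) (sym (double h)) (ℕP.+-mono-≤ e/2<j e/2<j))
  where
  h = e / 2
  e<2+h*2 : e < 2 ℕ.+ h ℕ.* 2
  e<2+h*2 = subst (_< 2 ℕ.+ h ℕ.* 2) (sym (m≡m%n+[m/n]*n e 2)) (ℕP.+-monoˡ-< (h ℕ.* 2) (m%n<n e 2))
  double : ∀ h → 2 ℕ.+ h ℕ.* 2 ≡ suc h ℕ.+ suc h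
  double = ℕ-Solver.solve-∀

S-truncated : ∀ n e → sumToℤ (e / 2) (ρ n e) ≡ S n e
S-truncated n e = begin
  sumToℤ (e / 2) (ρ n e)
    ≡⟨ sum-extend (e / 2) (e ∸ e / 2) (ρ n e) (λ j lt → ρ-vanishes n e j (half-bound e j lt)) ⟨
  sumToℤ (e / 2 ℕ.+ (e ∸ e / 2)) (ρ n e)
    ≡⟨ cong (λ x → sumToℤ x (ρ n e)) (ℕP.m+[n∸m]≡n (m/n≤m e 2)) ⟩
  S n e ∎

inverse-cancel : ∀ d x → (+ 1 ℚ./ suc d) ℚ.* toℚ (+ suc d * x) ≡ toℚ x
inverse-cancel d x = begin
  (+ 1 ℚ./ suc d) ℚ.* toℚ (+ suc d * x)   ≡⟨ ℚP.*-comm (+ 1 ℚ./ suc d) _ ⟩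
  toℚ (+ suc d * x) ℚ.* (+ 1 ℚ./ suc d)   ≡⟨ /-split (+ suc d * x) d ⟨
  (+ suc d * x) ℚ./ suc d                 ≡⟨ /-exact (+ suc d * x) x d refl ⟩
  toℚ x                                   ∎

sign-toℚ : ∀ k → sign k ≡ toℚ (signℤ k)
sign-toℚ zero    = refl
sign-toℚ (suc k) = trans (cong ℚ.-_ (sign-toℚ k)) (sym (toℚ-neg (signℤ k)))

sumTo-toℚ : ∀ n (f : ℕ → ℤ) → sumTo n (toℚ ∘ f) ≡ toℚ (sumToℤ n f)
sumTo-toℚ zero    f = refl
sumTo-toℚ (suc n) f =
  trans (cong (ℚ._+ toℚ (f (suc n))) (sumTo-toℚ n f)) (sym (toℚ-+ (sumToℤ n f) (f (suc n))))

sumTo-cong : ∀ n {f g : ℕ → ℚ} → (∀ k → k ≤ n → f k ≡ g k) → sumTo n f ≡ sumTo n g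
sumTo-cong zero    f≗g = f≗g 0 z≤n
sumTo-cong (suc n) f≗g =
  cong₂ ℚ._+_ (sumTo-cong n (λ k k≤n → f≗g k (ℕP.m≤n⇒m≤1+n k≤n))) (f≗g (suc n) ℕP.≤-refl)

sumTo-* : ∀ n c (f : ℕ → ℚ) → sumTo n (λ k → c ℚ.* f k) ≡ c ℚ.* sumTo n f
sumTo-* zero    c f = refl
sumTo-* (suc n) c f =
  trans (cong (ℚ._+ c ℚ.* f (suc n)) (sumTo-* n c f)) (sym (ℚP.*-distribˡ-+ c (sumTo n f) (f (suc n))))

catalan-toℚ : ∀ j → catalan j ≡ toℚ (catalanℤ j)
catalan-toℚ j = /-exact _ (catalanℤ j) j (begin
  + ((2 ℕ.* j) C j)              ≡⟨ cong (λ i → + ((j ℕ.+ i) C j)) (ℕP.+-identityʳ j) ⟩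
  binomial (j ℕ.+ j) j           ≡⟨ catalanℤ-central j ⟨
  (1ℤ + + j) * catalanℤ j        ∎)

binomial-reflect : ∀ n k → k ≤ n → (2 ℕ.* n ℕ.+ 3) C (n ∸ k) ≡ (3 ℕ.+ (n ℕ.+ n)) C (3 ℕ.+ (k ℕ.+ n))
binomial-reflect n k k≤n = begin
  (2 ℕ.* n ℕ.+ 3) C (n ∸ k)   ≡⟨ cong (λ N → N C (n ∸ k)) (double n) ⟩
  N C (n ∸ k)                 ≡⟨ nCk≡nC[n∸k] (ℕP.≤-trans (ℕP.m∸n≤m n k) (ℕP.m≤n+m n (3 ℕ.+ n))) ⟩
  N C (N ∸ (n ∸ k))           ≡⟨ cong (N C_) complement ⟩
  N C (3 ℕ.+ (k ℕ.+ n))       ∎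
  where
  N = 3 ℕ.+ (n ℕ.+ n)
  double : ∀ n → 2 ℕ.* n ℕ.+ 3 ≡ 3 ℕ.+ (n ℕ.+ n)
  double = ℕ-Solver.solve-∀
  regroup : ∀ x k n → 3 ℕ.+ (x ℕ.+ k ℕ.+ n) ≡ x ℕ.+ (3 ℕ.+ (k ℕ.+ n))
  regroup = ℕ-Solver.solve-∀
  complement : N ∸ (n ∸ k) ≡ 3 ℕ.+ (k ℕ.+ n)
  complement = trans (cong (λ x → 3 ℕ.+ (x ℕ.+ n) ∸ (n ∸ k)) (sym (ℕP.m∸n+n≡m k≤n)))
                     (trans (cong (_∸ (n ∸ k)) (regroup (n ∸ k) k n)) (ℕP.m+n∸m≡n (n ∸ k) _))

weight-cast : ∀ a k → + (a ℕ.* (k ℕ.+ 1) ℕ.* (k ℕ.+ 2) ℕ.* (2 ℕ.* k ℕ.+ 3)) ≡ + a * w (+ k)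
weight-cast a k = trans (cong +_ (regroup a k)) (ℤP.pos-* a (suc k ℕ.* (2 ℕ.+ k) ℕ.* (3 ℕ.+ (k ℕ.+ k))))
  where
  regroup : ∀ a k → a ℕ.* (k ℕ.+ 1) ℕ.* (k ℕ.+ 2) ℕ.* (2 ℕ.* k ℕ.+ 3)
                    ≡ a ℕ.* (suc k ℕ.* (2 ℕ.+ k) ℕ.* (3 ℕ.+ (k ℕ.+ k)))
  regroup = ℕ-Solver.solve-∀

denominator-cast : ∀ n m → + (suc n ℕ.* (3 ℕ.+ 2 ℕ.* n) ℕ.* suc m ℕ.* (3 ℕ.+ 2 ℕ.* m)) ≡ P (+ n) * P (+ m)
denominator-cast n m =
  trans (cong +_ (regroup n m)) (ℤP.pos-* (suc n ℕ.* (3 ℕ.+ (n ℕ.+ n))) (suc m ℕ.* (3 ℕ.+ (m ℕ.+ m))))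
  where
  regroup : ∀ n m → suc n ℕ.* (3 ℕ.+ 2 ℕ.* n) ℕ.* suc m ℕ.* (3 ℕ.+ 2 ℕ.* m)
                    ≡ suc n ℕ.* (3 ℕ.+ (n ℕ.+ n)) ℕ.* (suc m ℕ.* (3 ℕ.+ (m ℕ.+ m)))
  regroup = ℕ-Solver.solve-∀

lhsTerm-toℚ : ∀ m n k → k ≤ n → n ≤ m →
  lhsTerm m n k ≡ (+ 1 ℚ./ (suc n ℕ.* (3 ℕ.+ 2 ℕ.* n) ℕ.* suc m ℕ.* (3 ℕ.+ 2 ℕ.* m)))
                    ℚ.* toℚ (+ (m ∸ n) * τ n m k)
lhsTerm-toℚ m n k k≤n n≤m = begin
  sign k ℚ.* (+ N ℚ./ D) ℚ.* toℚ (+ b₁) ℚ.* toℚ (+ b₂)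
    ≡⟨ cong₂ (λ x y → x ℚ.* y ℚ.* toℚ (+ b₁) ℚ.* toℚ (+ b₂)) (sign-toℚ k) (/-split (+ N) _) ⟩
  toℚ (signℤ k) ℚ.* (toℚ (+ N) ℚ.* inv) ℚ.* toℚ (+ b₁) ℚ.* toℚ (+ b₂)
    ≡⟨ extract (toℚ (signℤ k)) (toℚ (+ N)) (toℚ (+ b₁)) (toℚ (+ b₂)) inv ⟩
  inv ℚ.* (toℚ (signℤ k) ℚ.* toℚ (+ N) ℚ.* toℚ (+ b₁) ℚ.* toℚ (+ b₂))
    ≡⟨ cong (inv ℚ.*_) (toℚ-*³ (signℤ k) (+ N) (+ b₁) (+ b₂)) ⟨
  inv ℚ.* toℚ (signℤ k * + N * + b₁ * + b₂)
    ≡⟨ cong (λ x → inv ℚ.* toℚ x) (cong₃ (λ x y z → signℤ k * x * y * z)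
                                         (weight-cast (m ∸ n) k)
                                         (cong +_ (binomial-reflect n k k≤n))
                                         (cong +_ (binomial-reflect m k (ℕP.≤-trans k≤n n≤m)))) ⟩
  inv ℚ.* toℚ (signℤ k * (+ (m ∸ n) * w (+ k)) * B n k 3 3 * B m k 3 3)
    ≡⟨ cong (λ x → inv ℚ.* toℚ x) (regroup (signℤ k) (+ (m ∸ n)) (w (+ k)) (B n k 3 3) (B m k 3 3)) ⟩
  inv ℚ.* toℚ (+ (m ∸ n) * τ n m k) ∎
  where
  N = (m ∸ n) ℕ.* (k ℕ.+ 1) ℕ.* (k ℕ.+ 2) ℕ.* (2 ℕ.* k ℕ.+ 3)
  D = suc n ℕ.* (3 ℕ.+ 2 ℕ.* n) ℕ.* suc m ℕ.* (3 ℕ.+ 2 ℕ.* m)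
  inv = + 1 ℚ./ D
  b₁ = (2 ℕ.* n ℕ.+ 3) C (n ∸ k)
  b₂ = (2 ℕ.* m ℕ.+ 3) C (m ∸ k)
  extract : ∀ (a b c d i : ℚ) → a ℚ.* (b ℚ.* i) ℚ.* c ℚ.* d ≡ i ℚ.* (a ℚ.* b ℚ.* c ℚ.* d)
  extract = solve 5 (λ a b c d i → a :* (b :* i) :* c :* d := i :* (a :* b :* c :* d)) refl
    where open +-*-Solver
  toℚ-*³ : ∀ a b c d → toℚ (a * b * c * d) ≡ toℚ a ℚ.* toℚ b ℚ.* toℚ c ℚ.* toℚ d
  toℚ-*³ a b c d = trans (toℚ-* (a * b * c) d)
                         (cong (ℚ._* toℚ d) (trans (toℚ-* (a * b) c) (cong (ℚ._* toℚ c) (toℚ-* a b))))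
  regroup : ∀ s a w b c → s * (a * w) * b * c ≡ a * (s * w * (b * c))
  regroup = solve-∀

rhsTerm-toℚ : ∀ m n j → rhsTerm m n j ≡ toℚ (ρ n (m ∸ n ∸ 1) j)
rhsTerm-toℚ m n j = begin
  sign j ℚ.* toℚ b ℚ.* catalan (n ℕ.+ j ℕ.+ 1) ℚ.* toℚ p
    ≡⟨ cong₂ (λ x y → x ℚ.* toℚ b ℚ.* y ℚ.* toℚ p) (sign-toℚ j) (catalan-toℚ (n ℕ.+ j ℕ.+ 1)) ⟩
  toℚ (signℤ j) ℚ.* toℚ b ℚ.* toℚ c ℚ.* toℚ p
    ≡⟨ cong (λ x → x ℚ.* toℚ c ℚ.* toℚ p) (toℚ-* (signℤ j) b) ⟨
  toℚ (signℤ j * b) ℚ.* toℚ c ℚ.* toℚ p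
    ≡⟨ cong (ℚ._* toℚ p) (toℚ-* (signℤ j * b) c) ⟨
  toℚ (signℤ j * b * c) ℚ.* toℚ p
    ≡⟨ toℚ-* (signℤ j * b * c) p ⟨
  toℚ (ρ n (m ∸ n ∸ 1) j) ∎
  where
  b = binomial (m ∸ n ∸ 1 ∸ j) j
  c = catalanℤ (n ℕ.+ j ℕ.+ 1)
  p = + (4 ^ (m ∸ n ∸ 1 ∸ 2 ℕ.* j))

lhs-value : ∀ m n → n ≤ m → sumTo n (lhsTerm m n) ≡ toℚ (F n (m ∸ n))
lhs-value m n n≤m = begin
  sumTo n (lhsTerm m n)
    ≡⟨ sumTo-cong n (λ k k≤n → lhsTerm-toℚ m n k k≤n n≤m) ⟩
  sumTo n (λ k → inv ℚ.* toℚ (+ (m ∸ n) * τ n m k))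
    ≡⟨ sumTo-* n inv _ ⟩
  inv ℚ.* sumTo n (λ k → toℚ (+ (m ∸ n) * τ n m k))
    ≡⟨ cong (inv ℚ.*_) (trans (sumTo-toℚ n _) (cong toℚ (sum-* n (+ (m ∸ n)) (τ n m)))) ⟩
  inv ℚ.* toℚ (+ (m ∸ n) * σ n m)
    ≡⟨ cong (λ x → inv ℚ.* toℚ x) closed-form ⟩
  inv ℚ.* toℚ (P (+ n) * P (+ m) * F n (m ∸ n))
    ≡⟨ cong (λ x → inv ℚ.* toℚ (x * F n (m ∸ n))) (denominator-cast n m) ⟨
  inv ℚ.* toℚ (+ D * F n (m ∸ n))
    ≡⟨ inverse-cancel (ℕ.pred D) (F n (m ∸ n)) ⟩
  toℚ (F n (m ∸ n)) ∎
  where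
  D = suc n ℕ.* (3 ℕ.+ 2 ℕ.* n) ℕ.* suc m ℕ.* (3 ℕ.+ 2 ℕ.* m)
  inv = + 1 ℚ./ D
  closed-form : + (m ∸ n) * σ n m ≡ P (+ n) * P (+ m) * F n (m ∸ n)
  closed-form = subst (λ m′ → + (m ∸ n) * σ n m′ ≡ P (+ n) * P (+ m′) * F n (m ∸ n))
                      (ℕP.m+[n∸m]≡n n≤m) (σ-closed-form (m ∸ n) n)

rhs-value : ∀ m n → sumTo ((m ∸ n ∸ 1) / 2) (rhsTerm m n) ≡ toℚ (S n (m ∸ n ∸ 1))
rhs-value m n = begin
  sumTo (E / 2) (rhsTerm m n)         ≡⟨ sumTo-cong (E / 2) (λ j _ → rhsTerm-toℚ m n j) ⟩
  sumTo (E / 2) (toℚ ∘ ρ n E)         ≡⟨ sumTo-toℚ (E / 2) (ρ n E) ⟩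
  toℚ (sumToℤ (E / 2) (ρ n E))        ≡⟨ cong toℚ (S-truncated n E) ⟩
  toℚ (S n E)                         ∎
  where E = m ∸ n ∸ 1

corollary3p6 : (m n : ℕ) → n < m →
    sumTo n (lhsTerm m n) ≡ sumTo ((m ∸ n ∸ 1) / 2) (rhsTerm m n)
corollary3p6 m n n<m = begin
  sumTo n (lhsTerm m n)                   ≡⟨ lhs-value m n (ℕP.<⇒≤ n<m) ⟩
  toℚ (F n (m ∸ n))                       ≡⟨ cong (toℚ ∘ F n) (∸-suc n<m) ⟩
  toℚ (F n (suc (m ∸ suc n)))             ≡⟨ cong toℚ (S≡F (m ∸ suc n) n) ⟨
  toℚ (S n (m ∸ suc n))                   ≡⟨ cong (toℚ ∘ S n ∘ (_∸ 1)) (∸-suc n<m) ⟨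
  toℚ (S n (m ∸ n ∸ 1))                   ≡⟨ rhs-value m n ⟨
  sumTo ((m ∸ n ∸ 1) / 2) (rhsTerm m n)   ∎
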